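{- Let $H$ be an instance as described in the context, let $M$ be an $\mathcal{A}$-perfect stable matching in $H$ and let $\mathcal{T}=\langle c(M(a_1)),\ldots,c(M(a_{|\mathcal{A}|}))\rangle$ be the tuple corresponding to $M$. Consider the following procedure on $\mathcal{T}=\langle c^1,\ldots,c^{|\mathcal{A}|}\rangle$: let $H'$ be the set of edges $(a_i,p)\in E$ with $c(p)=c^i$; then repeatedly (as long as every agent has at least one edge in $H'$ and deletions keep occurring), for every agent $a_i$ let $p$ be $a_i$'s most-preferred program with $(a_i,p)\in H'$, and for every program $p'$ with $p'>_{a_i}p$ and every agent $a$ with $a_i>_{p'}a$, delete $(a,p')$ from $H'$. Then no edge of $M$ is deleted during this procedure.
   Context: An instance consists of a bipartite graph $(\mathcal{A}\cup\mathcal{B},E)$, agents $\mathcal{A}=\{a_1,\dots,a_{|\mathcal{A}|}\}$, programs $\mathcal{B}$, $(a,p)\in E$ iff mutually acceptable. Each agent and each program ranks its neighbours in a strict order ($y>_x z$: $x$ prefers $y$ to $z$). Each program $p$ has a non-negative integer cost $c(p)$; programs have no quotas. A matching $M\subseteq E$ assigns each agent to at most one program (a program may receive any number of agents); $M(a)$, $M(p)$ denote partners. An agent prefers any acceptable program to being unmatched. A pair $(a,p)\in E\setminus M$ blocks $M$ if $p>_a M(a)$ and there is $a'\in M(p)$ with $a>_p a'$; $M$ is stable if no pair blocks it. $M$ is $\mathcal{A}$-perfect if every agent is matched. -}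

module Defs where

open import Level using (0ℓ)
open import Data.Nat using (ℕ; _<_; _≤_)
open import Data.Fin using (Fin)
open import Data.Product using (Σ; ∃; _×_)
open import Relation.Nullary using (¬_)
open import Relation.Binary.PropositionalEquality using (_≡_)
open import Relation.Binary.Construct.Closure.ReflexiveTransitive using (Star)

-- An instance: agents Fin nA, programs Fin nB, acceptability relation E,
-- strict preference orders given by rank functions (smaller rank = more
-- preferred), injective on the neighbourhood of each vertex, and costs.
record Instance : Set₁ where
  field
    nA nB  : ℕ
    E      : Fin nA → Fin nB → Set
    rankA  : Fin nA → Fin nB → ℕ
    rankP  : Fin nB → Fin nA → ℕ
    rankA-inj : ∀ a p q → E a p → E a q → rankA a p ≡ rankA a q → p ≡ q
    rankP-inj : ∀ p a b → E a p → E b p → rankP p a ≡ rankP p b → a ≡ b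
    cost   : Fin nB → ℕ

  _≻[_]_ : Fin nB → Fin nA → Fin nB → Set
  p ≻[ a ] q = rankA a p < rankA a q

  _▷[_]_ : Fin nA → Fin nB → Fin nA → Set
  a ▷[ p ] b = rankP p a < rankP p b

  -- An A-perfect matching: every agent is assigned a program it finds
  -- acceptable (programs have no quotas).
  record PerfectMatching : Set where
    field
      match  : Fin nA → Fin nB
      match∈E : ∀ a → E a (match a)

  open PerfectMatching public

  Blocks : PerfectMatching → Fin nA → Fin nB → Set
  Blocks M a p = E a p × (p ≻[ a ] match M a)
                 × (∃ λ a' → match M a' ≡ p × (a ▷[ p ] a'))

  Stable : PerfectMatching → Set
  Stable M = ∀ a p → ¬ Blocks M a p

  tuple : PerfectMatching → Fin nA → ℕ
  tuple M a = cost (match M a)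

  EdgeSet : Set₁
  EdgeSet = Fin nA → Fin nB → Set

  initial : (Fin nA → ℕ) → EdgeSet
  initial T a p = E a p × cost p ≡ T a

  Top : EdgeSet → Fin nA → Fin nB → Set
  Top H i p = H i p × (∀ q → H i q → rankA i p ≤ rankA i q)

  Deleted : EdgeSet → Fin nA → Fin nB → Set
  Deleted H a p' = ∃ λ i → ∃ λ p → Top H i p × E i p' × E a p'
                   × (p' ≻[ i ] p) × (i ▷[ p' ] a)

  Round : EdgeSet → EdgeSet → Set
  Round H H' = (∀ i → ∃ λ p → H i p)
               × (∀ a p → (H' a p → H a p × ¬ Deleted H a p)
                        × (H a p × ¬ Deleted H a p → H' a p))

  Reachable : (Fin nA → ℕ) → EdgeSet → Set₁
  Reachable T H = Star Round (initial T) H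

{-# OPTIONS --safe #-}
module Submission where

-- An edge (a , M a) can only be deleted by an agent i whose current top
-- program p is worse than M a for i while i ▷[ M a ] a.  As long as every
-- matching edge survives, i's top program is at least as good as M i, so
-- (i , M a) would block M.  Hence the matching edges are an invariant of
-- the procedure, and they all lie in the initial edge set by construction.

open import Defs
open import Data.Fin using (Fin)
open import Data.Nat.Properties using (<-≤-trans)
open import Data.Product using (_,_; proj₂)
open import Relation.Nullary using (¬_)
open import Relation.Binary.PropositionalEquality using (refl)
open import Relation.Binary.Construct.Closure.ReflexiveTransitive using (Star; ε; _◅_)

Star-invariant : ∀ {a r p} {A : Set a} {R : A → A → Set r} (P : A → Set p) →
                 (∀ {x y} → R x y → P x → P y) →
                 ∀ {x y} → Star R x y → P x → P y
Star-invariant P step ε        px = px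
Star-invariant P step (r ◅ rs) px = Star-invariant P step rs (step r px)

module _ (I : Instance) where
  open Instance I

  Contains : PerfectMatching → EdgeSet → Set
  Contains M H = ∀ a → H a (match M a)

  initial-contains : (M : PerfectMatching) → Contains M (initial (tuple M))
  initial-contains M a = match∈E M a , refl

  stable⇒¬deleted : (M : PerfectMatching) → Stable M → (H : EdgeSet) →
                    Contains M H → ∀ a → ¬ Deleted H a (match M a)
  stable⇒¬deleted M stable H contains a (i , p , (_ , top) , E-i , _ , pref , i▷a) =
    stable i (match M a)
      (E-i , <-≤-trans pref (top (match M i) (contains i)) , (a , refl , i▷a))

  round-preserves-contains : (M : PerfectMatching) → Stable M → {H H′ : EdgeSet} →
                             Round H H′ → Contains M H → Contains M H′
  round-preserves-contains M stable {H} (_ , round) contains a =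
    proj₂ (round a (match M a)) (contains a , stable⇒¬deleted M stable H contains a)

lemma3 : (I : Instance) → let open Instance I in
         (M : PerfectMatching) → Stable M →
         (H : EdgeSet) → Reachable (tuple M) H →
         (a : Fin nA) → H a (match M a)
lemma3 I M stable H reachable =
  Star-invariant (Contains I M) (round-preserves-contains I M stable)
                 reachable (initial-contains I M)
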